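{- Let $d\ge2$ and let $(G^*,(F_i),(g_i))$ be an admissible reconstruction datum, with $G^*$ having vertex set $R\sqcup\{b_1,\dots,b_m\}$. Let $X=R\sqcup\bigsqcup_{i=1}^m F_i$ (disjoint union of graphs, $R$ carrying the induced subgraph structure from $G^*$), let $G=X/\!\sim$ be the quotient graph obtained by identifying, for each $i$ and each $x\in N_{G^*}(b_i)$, the vertex $x\in R$ with the vertex $g_i(x)\in\partial F_i$, and let $\omega:X\to G$ be the canonical projection. Set $F_i'=F_i\setminus g_i(N_{G^*}(b_i))$, $B_i=\omega(F_i')$, and define $\pi:G\to G^*$ by $\pi(x)=x$ for $x\in\omega(R)$ (identified with $R$) and $\pi(x)=b_i$ for $x\in B_i$. Then $G$ is a finite tree all of whose vertices have degree at most $d$. Moreover: (a) $\omega$ is injective on $R$ and on each $F_i'$; (b) $V(G)=\omega(R)\sqcup B_1\sqcup\cdots\sqcup B_m$; (c) $\pi$ restricts to the identity on $\omega(R)$ and collapses each $B_i$ to $b_i$; (d) $B_1,\dots,B_m$ are precisely the connected components of $G\setminus\omega(R)$.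
   Context: $T_d$ is the $d$-regular tree. A domain is a finite nonempty connected vertex set of $T_d$; for $x\in D$, $\deg_D(x)$ is its number of neighbors in $D$; $\partial D=\{x\in D\mid\deg_D(x)<d\}$. A domain $D$ with $|D|\ge2$ is full if every $x\in\partial D$ has $\deg_D(x)=1$. A stem diagram is a finite tree $G^*$ with vertex set partitioned as $R\sqcup B$ such that no edge joins two vertices of $B$ and every leaf of $G^*$ lies in $B$. An admissible reconstruction datum $(G^*,(F_i),(g_i))$ consists of: (i) a stem diagram $G^*$ with $B=\{b_1,\dots,b_m\}$ such that $2\le\deg_{G^*}(x)\le d-1$ for every $x\in R$; (ii) full domains $F_1,\dots,F_m$ in $T_d$ with $|\partial F_i|\ge\deg_{G^*}(b_i)$; (iii) for each $i$, an injective map $g_i:N_{G^*}(b_i)\to\partial F_i$, where $N_{G^*}(b_i)\subset R$ is the set of neighbors of $b_i$ in $G^*$. -}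

module Defs where

open import Data.Nat using (ℕ; _≤_; _<_; _<ᵇ_; _∸_)
open import Data.Fin using (Fin; _≟_)
open import Data.Bool using (Bool; true; false; _∨_)
open import Data.List using (List; []; _∷_; length; filterᵇ; allFin; map; _++_; [_]; lookup)
open import Data.List.Properties using (≡-dec)
open import Data.List.Membership.Propositional using (_∈_)
open import Data.List.Relation.Unary.Unique.Propositional using (Unique)
open import Data.List.Relation.Unary.AllPairs using (AllPairs)
open import Data.Product using (Σ; ∃; _×_; _,_)
open import Data.Sum using (_⊎_; inj₁; inj₂)
open import Data.Unit using (⊤)
open import Data.Empty using (⊥)
open import Relation.Nullary using (¬_; ⌊_⌋)
open import Relation.Binary.PropositionalEquality using (_≡_; _≢_)
open import Relation.Binary.Construct.Closure.ReflexiveTransitive using (Star)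
open import Relation.Binary.Construct.Closure.Equivalence using (EqClosure)

-- Generic (simple) graphs on a type with an equivalence "≈"
-- (≈ is ≡ for ordinary graphs, and the identifying relation for a
-- quotient graph, whose vertices are the ≈-classes).

Chain : {V : Set} → (V → V → Set) → List V → Set
Chain E []            = ⊤
Chain E (a ∷ [])      = ⊤
Chain E (a ∷ b ∷ vs)  = E a b × Chain E (b ∷ vs)

record IsTree (V : Set) (_≈_ : V → V → Set) (E : V → V → Set) : Set where
  field
    point     : V
    symmetric : ∀ u v → E u v → E v u
    loopless  : ∀ u v → E u v → ¬ (u ≈ v)
    connected : ∀ u v → Star (λ a b → (a ≈ b) ⊎ E a b) u v
    acyclic   : ∀ v vs → 2 ≤ length vs → AllPairs (λ a b → ¬ (a ≈ b)) (v ∷ vs)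
                  → ¬ Chain E (v ∷ vs ++ [ v ])

MaxDegree≤ : {V : Set} → (V → V → Set) → (V → V → Set) → ℕ → Set
MaxDegree≤ {V} _≈_ E d = ∀ (v : V) (ns : List V) → AllPairs (λ a b → ¬ (a ≈ b)) ns
  → (∀ w → w ∈ ns → E v w) → length ns ≤ d

-- The d-regular tree T_d: vertices are reduced words over Fin d
-- (Cayley graph of the free product of d copies of ℤ/2); w is
-- adjacent to a ∷ w.

Word : ℕ → Set
Word d = List (Fin d)

Reduced : {d : ℕ} → Word d → Set
Reduced []            = ⊤
Reduced (a ∷ [])      = ⊤
Reduced (a ∷ b ∷ w)   = (a ≢ b) × Reduced (b ∷ w)

child : {d : ℕ} → Word d → Word d → Bool
child u []      = false
child u (a ∷ v) = ⌊ ≡-dec _≟_ v u ⌋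

adjT : {d : ℕ} → Word d → Word d → Bool
adjT u v = child u v ∨ child v u

degIn : {d : ℕ} → List (Word d) → Word d → ℕ
degIn D x = length (filterᵇ (adjT x) D)

boundary : (d : ℕ) → List (Word d) → List (Word d)
boundary d D = filterᵇ (λ x → degIn D x <ᵇ d) D

record IsDomain (d : ℕ) (D : List (Word d)) : Set where
  field
    reduced   : ∀ x → x ∈ D → Reduced x
    unique    : Unique D
    nonempty  : ∃ λ x → x ∈ D
    connected : ∀ x y → x ∈ D → y ∈ D
                  → Star (λ a b → (a ∈ D) × (b ∈ D) × (adjT a b ≡ true)) x y

record IsFullDomain (d : ℕ) (D : List (Word d)) : Set where
  field
    domain : IsDomain d D
    size≥2 : 2 ≤ length D
    full   : ∀ x → x ∈ D → degIn D x < d → degIn D x ≡ 1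

-- Stem diagrams: vertex set R ⊔ B with R = Fin r, B = Fin m,
-- adjacency given by a Bool-valued relation.

V* : ℕ → ℕ → Set
V* r m = Fin r ⊎ Fin m

allV* : (r m : ℕ) → List (V* r m)
allV* r m = map inj₁ (allFin r) ++ map inj₂ (allFin m)

deg* : {r m : ℕ} → (V* r m → V* r m → Bool) → V* r m → ℕ
deg* {r} {m} adj v = length (filterᵇ (adj v) (allV* r m))

record IsStemDiagram (r m : ℕ) (adj : V* r m → V* r m → Bool) : Set where
  field
    tree      : IsTree (V* r m) _≡_ (λ u v → adj u v ≡ true)
    noBB      : ∀ i j → adj (inj₂ i) (inj₂ j) ≡ false
    leavesInB : ∀ x → ¬ (deg* adj (inj₁ x) ≡ 1)

-- Admissible reconstruction datum.  F i is the full domain F_i; its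
-- vertices are the positions Fin (length (F i)).  g i : Fin r → Fin _
-- is a total function; only its values on N(b_i) matter.

module Datum (d r m : ℕ) (adj : V* r m → V* r m → Bool)
             (F : Fin m → List (Word d))
             (g : (i : Fin m) → Fin r → Fin (length (F i))) where

  Nb : Fin m → Fin r → Set
  Nb i x = adj (inj₁ x) (inj₂ i) ≡ true

  record Admissible : Set where
    field
      stem     : IsStemDiagram r m adj
      degR     : ∀ x → 2 ≤ deg* adj (inj₁ x) × deg* adj (inj₁ x) ≤ d ∸ 1
      fullF    : ∀ i → IsFullDomain d (F i)
      bigBdry  : ∀ i → deg* adj (inj₂ i) ≤ length (boundary d (F i))
      gBdry    : ∀ i x → Nb i x → degIn (F i) (lookup (F i) (g i x)) < d
      gInj     : ∀ i x y → Nb i x → Nb i y → g i x ≡ g i y → x ≡ y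

  X : Set
  X = Fin r ⊎ Σ (Fin m) (λ i → Fin (length (F i)))

  XAdj : X → X → Set
  XAdj (inj₁ x) (inj₁ y) = adj (inj₁ x) (inj₁ y) ≡ true
  XAdj (inj₁ x) (inj₂ q) = ⊥
  XAdj (inj₂ p) (inj₁ y) = ⊥
  XAdj (inj₂ (i , p)) (inj₂ (j , q)) =
    (i ≡ j) × (adjT (lookup (F i) p) (lookup (F j) q) ≡ true)

  data Ident : X → X → Set where
    ident : ∀ i x → Nb i x → Ident (inj₁ x) (inj₂ (i , g i x))

  -- equivalence relation defining the quotient G = X/∼ ; ω is the
  -- identity on representatives
  _≈_ : X → X → Set
  _≈_ = EqClosure Ident

  GAdj : X → X → Set
  GAdj u v = ∃ λ u' → ∃ λ v' → (u ≈ u') × (v ≈ v') × XAdj u' v'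

  InF' : (i : Fin m) → Fin (length (F i)) → Set
  InF' i p = ∀ x → Nb i x → ¬ (g i x ≡ p)

  InωR : X → Set
  InωR v = ∃ λ x → v ≈ inj₁ x

  InB : Fin m → X → Set
  InB i v = ∃ λ p → InF' i p × (v ≈ inj₂ (i , p))

  AdjOff : X → X → Set
  AdjOff u v = ¬ InωR u × ¬ InωR v × GAdj u v

-- Every ≈-class has a canonical representative: a vertex x of R (which also
-- represents the glued vertex g_i x) or a free vertex of some F_i.  This gives
-- (a)-(c) directly.  Because a glued vertex g_i x is a leaf of the full domain
-- F_i, an edge of G leaving a representative is determined by the neighbour
-- of x in G*, resp. the neighbour in F_i ⊂ T_d, that it heads to.  This bounds
-- degrees by deg_{G*} x ≤ d - 1, resp. d, and it shows that a non-backtracking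
-- walk in G projects to a non-backtracking walk in the tree G* and, while it
-- stays in one F_i, to one in T_d; so G has no cycle.  Paths of G* lift to G
-- through the connected F_i, and B_i stays connected after removing the glued
-- leaves, while no edge leaves B_i except into ω(R), which gives (d).
module Submission where

open import Defs
open import Data.Nat using (ℕ; suc; _≤_; _<_; z≤n; s≤s)
open import Data.Nat.Properties using (≤-refl; ≤-trans; <-irrefl; m<n⇒m<1+n; m∸n≤m; _≤?_; ≰⇒>)
open import Data.Fin as Fin using (Fin; _≟_)
import Data.Fin.Properties as Finₚ
import Data.Sum.Properties as Sumₚ
open import Data.Bool using (Bool; true; false; T?)
open import Data.Bool.Properties using (∨-comm; T-≡)
open import Data.Maybe using (Maybe; just; nothing)
import Data.Maybe as Maybe
open import Data.List using (List; []; _∷_; length; lookup; filterᵇ; allFin; map; _++_; [_]; _∷ʳ_)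
open import Data.List.Properties
  using (≡-dec; ++-assoc; ++-cancelʳ; ∷ʳ-injective; ∷-injective; map-++; length-map)
open import Data.List.Relation.Unary.All as All using (All; []; _∷_)
open import Data.List.Relation.Unary.All.Properties using (¬Any⇒All¬)
import Data.List.Relation.Unary.All.Properties as All
open import Data.List.Relation.Unary.Any using (here; there; index)
open import Data.List.Relation.Unary.Any.Properties using (lookup-index)
open import Data.List.Relation.Unary.AllPairs as AllPairs using (AllPairs; []; _∷_)
import Data.List.Relation.Unary.AllPairs.Properties as AllPairs
open import Data.List.Membership.Propositional using (_∈_)
open import Data.List.Membership.Propositional.Properties
  using (∈-∃++; ∈-lookup; ∈-filter⁺; ∈-map⁺; ∈-map⁻; ∈-++⁺ˡ; ∈-++⁺ʳ; ∈-allFin)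
import Data.List.Membership.DecPropositional as DecMembership
open import Data.Product using (∃; ∃₂; _×_; _,_; proj₁; proj₂)
open import Data.Sum using (_⊎_; inj₁; inj₂)
open import Data.Unit using (⊤; tt)
open import Data.Empty using (⊥; ⊥-elim)
open import Function using (Equivalence; _∘_)
open import Relation.Nullary using (¬_; Dec; yes; no)
open import Relation.Nullary.Decidable using (_×-dec_)
open import Relation.Binary.Definitions using (DecidableEquality; tri<; tri≈; tri>)
open import Relation.Binary.PropositionalEquality using (_≡_; _≢_; refl; sym; trans; cong; subst; subst₂)
open import Relation.Binary.Construct.Closure.ReflexiveTransitive using (Star; ε; _◅_; _◅◅_; gmap)
open import Relation.Binary.Construct.Closure.Symmetric using (fwd; bwd)
import Relation.Binary.Construct.Closure.Equivalence as EqClosure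

Distinct : {A : Set} → List A → Set
Distinct = AllPairs _≢_

Chain₂ : {A : Set} → (A → A → Set) → List A → Set
Chain₂ R (a ∷ b ∷ c ∷ xs) = R a c × Chain₂ R (b ∷ c ∷ xs)
Chain₂ R _                = ⊤

module _ {A : Set} where

  Chain-++⁻ˡ : {E : A → A → Set} (xs ys : List A) → Chain E (xs ++ ys) → Chain E xs
  Chain-++⁻ˡ []           ys _       = tt
  Chain-++⁻ˡ (a ∷ [])     ys _       = tt
  Chain-++⁻ˡ (a ∷ b ∷ xs) ys (e , c) = e , Chain-++⁻ˡ (b ∷ xs) ys c

  AllPairs-++⁻ˡ : {R : A → A → Set} (xs ys : List A) → AllPairs R (xs ++ ys) → AllPairs R xs
  AllPairs-++⁻ˡ []       ys _         = []
  AllPairs-++⁻ˡ (x ∷ xs) ys (px ∷ p) = All.++⁻ˡ xs px ∷ AllPairs-++⁻ˡ xs ys p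

  AllPairs-before : {R : A → A → Set} (xs : List A) {u : A} {ys : List A}
    → AllPairs R (xs ++ u ∷ ys) → All (λ z → R z u) xs
  AllPairs-before []       _         = []
  AllPairs-before (x ∷ xs) (px ∷ p) = All.head (All.++⁻ʳ xs px) ∷ AllPairs-before xs p

  AllPairs-lookup : {R : A → A → Set} {xs : List A} → AllPairs R xs
    → {j j' : Fin (length xs)} → j Fin.< j' → R (lookup xs j) (lookup xs j')
  AllPairs-lookup (px ∷ _) {Fin.zero}  {Fin.suc j'} _         = All.lookup px (∈-lookup j')
  AllPairs-lookup (_ ∷ p)  {Fin.suc j} {Fin.suc j'} (s≤s j<j') = AllPairs-lookup p j<j'

  lookup-injective : {xs : List A} → Distinct xs
    → (j j' : Fin (length xs)) → lookup xs j ≡ lookup xs j' → j ≡ j'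
  lookup-injective xs! j j' eq with Finₚ.<-cmp j j'
  ... | tri< j<j' _ _ = ⊥-elim (AllPairs-lookup xs! j<j' eq)
  ... | tri≈ _ j≡j' _ = j≡j'
  ... | tri> _ _ j'<j = ⊥-elim (AllPairs-lookup xs! j'<j (sym eq))

  Distinct-length≤ : {xs : List A} {K : ℕ} → Distinct xs → (f : Fin (length xs) → Fin K)
    → (∀ j j' → f j ≡ f j' → lookup xs j ≡ lookup xs j') → length xs ≤ K
  Distinct-length≤ {xs} {K} xs! f f-inj with length xs ≤? K
  ... | yes ≤K = ≤K
  ... | no ≰K with Finₚ.pigeonhole (≰⇒> ≰K) f
  ... | j , j' , j<j' , fj≡fj' = ⊥-elim (AllPairs-lookup xs! j<j' (f-inj j j' fj≡fj'))

  ∈-filterᵇ⁺ : (p : A → Bool) {x : A} {xs : List A} → x ∈ xs → p x ≡ true → x ∈ filterᵇ p xs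
  ∈-filterᵇ⁺ p x∈ px = ∈-filter⁺ (T? ∘ p) x∈ (Equivalence.from T-≡ px)

  Distinct-head∉ : {x : A} {xs : List A} → Distinct (x ∷ xs) → ¬ x ∈ xs
  Distinct-head∉ (x∉ ∷ _) x∈ = All.lookup x∉ x∈ refl

  Chain-map : {B : Set} {E : A → A → Set} {E' : B → B → Set} (f : A → B)
    → (∀ {a b} → E a b → E' (f a) (f b)) → (xs : List A) → Chain E xs → Chain E' (map f xs)
  Chain-map f h []           _       = tt
  Chain-map f h (a ∷ [])     _       = tt
  Chain-map f h (a ∷ b ∷ xs) (e , c) = h e , Chain-map f h (b ∷ xs) c

  Chain₂-map : {B : Set} {R : A → A → Set} {R' : B → B → Set} (f : A → B)
    → (∀ {a b} → R a b → R' (f a) (f b)) → (xs : List A) → Chain₂ R xs → Chain₂ R' (map f xs)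
  Chain₂-map f h []               _       = tt
  Chain₂-map f h (a ∷ [])         _       = tt
  Chain₂-map f h (a ∷ b ∷ [])     _       = tt
  Chain₂-map f h (a ∷ b ∷ c ∷ xs) (r , t) = h r , Chain₂-map f h (b ∷ c ∷ xs) t

  AllPairs⇒Chain₂-∷ʳ : {R : A → A → Set} (v : A) (ws : List A) → AllPairs R ws
    → All (λ w → R w v) ws → Chain₂ R (ws ++ [ v ])
  AllPairs⇒Chain₂-∷ʳ v []               _                     _        = tt
  AllPairs⇒Chain₂-∷ʳ v (a ∷ [])         _                     _        = tt
  AllPairs⇒Chain₂-∷ʳ v (a ∷ b ∷ [])     _                     (Rav ∷ _) = Rav , tt
  AllPairs⇒Chain₂-∷ʳ v (a ∷ b ∷ c ∷ ws) ((_ ∷ Rac ∷ _) ∷ ws!) (_ ∷ Rwv) =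
    Rac , AllPairs⇒Chain₂-∷ʳ v (b ∷ c ∷ ws) ws! Rwv

  length≡1⇒≡ : {x y : A} (xs : List A) → length xs ≡ 1 → x ∈ xs → y ∈ xs → x ≡ y
  length≡1⇒≡ (_ ∷ []) _ (here refl) (here refl) = refl

-- Paths in a tree are stored reversed, the current endpoint first.
module TreePaths {V : Set} (_≟V_ : DecidableEquality V) {E : V → V → Set}
                 (tree : IsTree V _≡_ E) where
  open IsTree tree
  open DecMembership _≟V_ using (_∈?_)

  NotBack : V → List V → Set
  NotBack u []      = ⊤
  NotBack u (s ∷ _) = u ≢ s

  private
    revisit⇒cycle : ∀ {q qs u} pre post → q ∷ qs ≡ pre ++ u ∷ post → Distinct (q ∷ qs)
      → Chain E (q ∷ qs) → E q u → NotBack u qs → ⊥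
    revisit⇒cycle [] post refl _ _ e _ = loopless _ _ e refl
    revisit⇒cycle (a ∷ []) post refl _ _ _ nb = nb refl
    revisit⇒cycle {u = u} (a ∷ b ∷ pre) post refl xs! ch e _ =
      acyclic u (a ∷ b ∷ pre) (s≤s (s≤s z≤n)) cycle! cycle
      where
        cycle! : Distinct (u ∷ a ∷ b ∷ pre)
        cycle! = All.map (λ z≢u u≡z → z≢u (sym u≡z)) (AllPairs-before (a ∷ b ∷ pre) xs!)
               ∷ AllPairs-++⁻ˡ (a ∷ b ∷ pre) (u ∷ post) xs!
        cycle : Chain E (u ∷ (a ∷ b ∷ pre) ++ [ u ])
        cycle = Chain-++⁻ˡ (u ∷ (a ∷ b ∷ pre) ++ [ u ]) post
                  (subst (λ zs → Chain E (u ∷ zs)) (sym (++-assoc (a ∷ b ∷ pre) [ u ] post))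
                         (symmetric a u e , ch))

  extend-path : ∀ {q qs u} → Distinct (q ∷ qs) → Chain E (q ∷ qs) → E q u → NotBack u qs
         → Distinct (u ∷ q ∷ qs)
  extend-path {q} {qs} {u} xs! ch e nb with u ∈? (q ∷ qs)
  ... | no u∉ = ¬Any⇒All¬ (q ∷ qs) u∉ ∷ xs!
  ... | yes u∈ with ∈-∃++ u∈
  ... | pre , post , eq = ⊥-elim (revisit⇒cycle pre post eq xs! ch e nb)

module RegularTree (d : ℕ) where

  private
    W : Set
    W = Word d

  child⇒ : (u w : W) → child u w ≡ true → ∃ λ a → w ≡ a ∷ u
  child⇒ u (a ∷ v) eq with ≡-dec _≟_ v u
  ... | yes refl = a , refl
  child⇒ u (a ∷ v) () | no _

  adjT⇒ : (u w : W) → adjT u w ≡ true → (∃ λ a → w ≡ a ∷ u) ⊎ (∃ λ a → u ≡ a ∷ w)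
  adjT⇒ u w eq with child u w in u◁w
  ... | true  = inj₁ (child⇒ u w u◁w)
  ... | false = inj₂ (child⇒ w u eq)

  adjT-sym : (u w : W) → adjT u w ≡ true → adjT w u ≡ true
  adjT-sym u w = trans (∨-comm (child w u) (child u w))

  ≢-++-∷ : (C : W) (c : Fin d) (w : W) → w ≢ C ++ c ∷ w
  ≢-++-∷ C c w eq = <-irrefl refl (subst (λ z → length w < length z) (sym eq) (shorter C))
    where
      shorter : (C : W) → length w < length (C ++ c ∷ w)
      shorter []      = ≤-refl
      shorter (_ ∷ C) = m<n⇒m<1+n (shorter C)

  adjT-irrefl : (w : W) → adjT w w ≢ true
  adjT-irrefl w eq with adjT⇒ w w eq
  ... | inj₁ (a , e) = ≢-++-∷ [] a w e
  ... | inj₂ (a , e) = ≢-++-∷ [] a w e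

  letter : (u w : W) → adjT u w ≡ true → Fin d
  letter u w a with adjT⇒ u w a
  ... | inj₁ (b , _) = b
  ... | inj₂ (b , _) = b

  letter-injective : (u w w' : W) (a : adjT u w ≡ true) (a' : adjT u w' ≡ true)
    → Reduced w → Reduced w' → letter u w a ≡ letter u w' a' → w ≡ w'
  letter-injective u w w' a a' rw rw' eq with adjT⇒ u w a | adjT⇒ u w' a'
  ... | inj₁ (b , e) | inj₁ (b' , e') = trans e (trans (cong (_∷ u) eq) (sym e'))
  ... | inj₂ (b , e) | inj₂ (b' , e') = proj₂ (∷-injective (trans (sym e) e'))
  ... | inj₁ (b , e) | inj₂ (b' , e') =
    ⊥-elim (proj₁ (subst Reduced (trans e (cong (b ∷_) e')) rw) eq)
  ... | inj₂ (b , e) | inj₁ (b' , e') =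
    ⊥-elim (proj₁ (subst Reduced (trans e' (cong (b' ∷_) e)) rw') (sym eq))

  Turn : W → W → Fin d → Set
  Turn w₀ s f = (w₀ ≡ s) ⊎ (∃₂ λ C c → (w₀ ≡ C ++ c ∷ s) × c ≢ f)

  -- Walk w₀ prev cur: cur is the end of a non-backtracking walk from w₀ whose
  -- last step left prev.  Such a walk first descends through suffixes of w₀
  -- and, once it turns at a suffix s, climbs away from w₀ with a letter f ∷ s
  -- that differs from the letter of w₀ above s.
  data Walk (w₀ : W) : Maybe W → W → Set where
    start : Walk w₀ nothing w₀
    down  : ∀ {prev cur} C c → prev ≡ c ∷ cur → w₀ ≡ C ++ prev → Walk w₀ (just prev) cur
    up    : ∀ {prev cur} e C f s → cur ≡ e ∷ prev → cur ≡ C ++ f ∷ s → Turn w₀ s f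
          → Walk w₀ (just prev) cur

  Walk-away : ∀ {w₀ prev cur} → Walk w₀ (just prev) cur → cur ≢ w₀
  Walk-away (down C c refl w₀≡) refl = ≢-++-∷ C c _ w₀≡
  Walk-away (up e C f s _ cur≡ (inj₁ refl)) refl = ≢-++-∷ C f _ cur≡
  Walk-away (up e C f s _ cur≡ (inj₂ (C' , c , w₀≡ , c≢f))) refl =
    c≢f (sym (proj₂ (∷ʳ-injective C C' (++-cancelʳ s (C ∷ʳ f) (C' ∷ʳ c) same))))
    where
      same : (C ∷ʳ f) ++ s ≡ (C' ∷ʳ c) ++ s
      same = trans (++-assoc C [ f ] s) (trans (sym cur≡) (trans w₀≡ (sym (++-assoc C' [ c ] s))))

  Walk-step : ∀ {w₀ prev cur next} → Walk w₀ prev cur → adjT cur next ≡ true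
    → (∀ p → prev ≡ just p → next ≢ p) → Walk w₀ (just cur) next
  Walk-step {w₀} {cur = cur} start a _ with adjT⇒ cur _ a
  ... | inj₁ (f , e) = up f [] f w₀ e e (inj₁ refl)
  ... | inj₂ (c , e) = down [] c e refl
  Walk-step {cur = cur} (down C c prev≡ w₀≡) a nb with adjT⇒ cur _ a
  ... | inj₁ (f , e) =
    up f [] f cur e e (inj₂ (C , c , trans w₀≡ (cong (C ++_) prev≡) , c≢f))
    where
      c≢f : c ≢ f
      c≢f c≡f = nb _ refl (trans e (trans (cong (_∷ cur) (sym c≡f)) (sym prev≡)))
  ... | inj₂ (c' , e) =
    down (C ∷ʳ c) c' e (trans w₀≡ (trans (cong (C ++_) prev≡) (sym (++-assoc C [ c ] cur))))
  Walk-step (up e C f s cur≡ cur≡' turn) a nb with adjT⇒ _ _ a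
  ... | inj₁ (e' , next≡) = up e' (e' ∷ C) f s next≡ (trans next≡ (cong (e' ∷_) cur≡')) turn
  ... | inj₂ (e' , cur≡'') = ⊥-elim (nb _ refl (proj₂ (∷-injective (trans (sym cur≡'') cur≡))))

module Gluing (d r m : ℕ) (adj : V* r m → V* r m → Bool)
              (F : Fin m → List (Word d))
              (g : (i : Fin m) → Fin r → Fin (length (F i)))
              (A : Datum.Admissible d r m adj F g) where
  open Datum d r m adj F g
  open Admissible A
  open RegularTree d

  E* : V* r m → V* r m → Set
  E* u v = adj u v ≡ true

  stemTree : IsTree (V* r m) _≡_ E*
  stemTree = IsStemDiagram.tree stem

  E*-sym : ∀ {u v} → E* u v → E* v u
  E*-sym = IsTree.symmetric stemTree _ _

  Pos : Fin m → Set
  Pos i = Fin (length (F i))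

  word : (i : Fin m) → Pos i → Word d
  word i p = lookup (F i) p

  AdjF : (i : Fin m) → Pos i → Pos i → Set
  AdjF i p q = adjT (word i p) (word i q) ≡ true

  AdjF-sym : ∀ {i p q} → AdjF i p q → AdjF i q p
  AdjF-sym {i} {p} {q} = adjT-sym (word i p) (word i q)

  domainF : ∀ i → IsDomain d (F i)
  domainF i = IsFullDomain.domain (fullF i)

  word-injective : ∀ i {p q} → word i p ≡ word i q → p ≡ q
  word-injective i = lookup-injective (IsDomain.unique (domainF i)) _ _

  word-reduced : ∀ i p → Reduced (word i p)
  word-reduced i p = IsDomain.reduced (domainF i) (word i p) (∈-lookup p)

  leaf-neighbour-unique : ∀ i p {a b} → degIn (F i) (word i p) ≡ 1 → AdjF i p a → AdjF i p b → a ≡ b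
  leaf-neighbour-unique i p deg≡1 pa pb = word-injective i
    (length≡1⇒≡ (filterᵇ (adjT (word i p)) (F i)) deg≡1
      (∈-filterᵇ⁺ (adjT (word i p)) (∈-lookup {xs = F i} _) pa)
      (∈-filterᵇ⁺ (adjT (word i p)) (∈-lookup {xs = F i} _) pb))

  Glued : (i : Fin m) → Pos i → Set
  Glued i p = ∃ λ x → Nb i x × g i x ≡ p

  glued? : ∀ i p → Dec (Glued i p)
  glued? i p = Finₚ.any? (λ x → (adj (inj₁ x) (inj₂ i) Data.Bool.≟ true) ×-dec (g i x Finₚ.≟ p))

  ¬glued⇒free : ∀ {i p} → ¬ Glued i p → InF' i p
  ¬glued⇒free ¬gl x nb gx≡p = ¬gl (x , nb , gx≡p)

  glued-leaf : ∀ {i p} → Glued i p → degIn (F i) (word i p) ≡ 1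
  glued-leaf {i} (x , nb , refl) =
    IsFullDomain.full (fullF i) (word i (g i x)) (∈-lookup (g i x)) (gBdry i x nb)

  glued-neighbour-unique : ∀ {i x a b} → Nb i x → AdjF i (g i x) a → AdjF i (g i x) b → a ≡ b
  glued-neighbour-unique {i} {x} nb = leaf-neighbour-unique i (g i x) (glued-leaf (x , nb , refl))

  nf : X → X
  nf (inj₁ x) = inj₁ x
  nf (inj₂ (i , p)) with glued? i p
  ... | yes (x , _) = inj₁ x
  ... | no _        = inj₂ (i , p)

  data Canonical : X → Set where
    stemVertex : ∀ x → Canonical (inj₁ x)
    freeVertex : ∀ i p → InF' i p → Canonical (inj₂ (i , p))

  nf-canonical : ∀ u → Canonical (nf u)
  nf-canonical (inj₁ x) = stemVertex x
  nf-canonical (inj₂ (i , p)) with glued? i p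
  ... | yes (x , _) = stemVertex x
  ... | no ¬gl      = freeVertex i p (¬glued⇒free ¬gl)

  nf-glued : ∀ {i x} → Nb i x → nf (inj₂ (i , g i x)) ≡ inj₁ x
  nf-glued {i} {x} nb with glued? i (g i x)
  ... | yes (x' , nb' , eq) = cong inj₁ (gInj i x' x nb' nb eq)
  ... | no ¬gl              = ⊥-elim (¬gl (x , nb , refl))

  nf-free : ∀ {i p} → InF' i p → nf (inj₂ (i , p)) ≡ inj₂ (i , p)
  nf-free {i} {p} free with glued? i p
  ... | yes (x , nb , eq) = ⊥-elim (free x nb eq)
  ... | no _              = refl

  nf≡inj₂ : ∀ u {i p} → nf u ≡ inj₂ (i , p) → u ≡ inj₂ (i , p)
  nf≡inj₂ (inj₂ (j , q)) eq with glued? j q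
  nf≡inj₂ (inj₂ (j , q)) () | yes _
  nf≡inj₂ (inj₂ (j , q)) eq | no _ = eq

  ≈⇒nf≡ : ∀ {u v} → u ≈ v → nf u ≡ nf v
  ≈⇒nf≡ ε                               = refl
  ≈⇒nf≡ (fwd (ident i x nb) ◅ u≈v) = trans (sym (nf-glued nb)) (≈⇒nf≡ u≈v)
  ≈⇒nf≡ (bwd (ident i x nb) ◅ u≈v) = trans (nf-glued nb) (≈⇒nf≡ u≈v)

  ≈-nf : ∀ u → u ≈ nf u
  ≈-nf (inj₁ x) = ε
  ≈-nf (inj₂ (i , p)) with glued? i p
  ... | yes (x , nb , refl) = bwd (ident i x nb) ◅ ε
  ... | no _                = ε

  ≈-sym : ∀ {u v} → u ≈ v → v ≈ u
  ≈-sym = EqClosure.symmetric Ident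

  nf≡⇒≈ : ∀ {u v} → nf u ≡ nf v → u ≈ v
  nf≡⇒≈ {u} {v} eq = ≈-nf u ◅◅ subst (_≈ v) (sym eq) (≈-sym (≈-nf v))

  -- An `across` edge only occurs when F_i = {g_i x, g_i y}.
  data Edge : X → X → Set where
    stemEdge : ∀ x y → E* (inj₁ x) (inj₁ y) → Edge (inj₁ x) (inj₁ y)
    enter    : ∀ i x q → Nb i x → InF' i q → AdjF i (g i x) q → Edge (inj₁ x) (inj₂ (i , q))
    leave    : ∀ i p y → InF' i p → Nb i y → AdjF i p (g i y) → Edge (inj₂ (i , p)) (inj₁ y)
    inside   : ∀ i p q → InF' i p → InF' i q → AdjF i p q → Edge (inj₂ (i , p)) (inj₂ (i , q))
    across   : ∀ i x y → Nb i x → Nb i y → AdjF i (g i x) (g i y) → Edge (inj₁ x) (inj₁ y)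

  Edge-irrefl : ∀ {u} → ¬ Edge u u
  Edge-irrefl (stemEdge x .x a)        = IsTree.loopless stemTree _ _ a refl
  Edge-irrefl (inside i p .p _ _ a)    = adjT-irrefl (word i p) a
  Edge-irrefl (across i x .x _ _ a)    = adjT-irrefl (word i (g i x)) a

  XAdj⇒Edge : ∀ u v → XAdj u v → Edge (nf u) (nf v)
  XAdj⇒Edge (inj₁ x) (inj₁ y) a = stemEdge x y a
  XAdj⇒Edge (inj₂ (i , p)) (inj₂ (.i , q)) (refl , a) with glued? i p | glued? i q
  ... | yes (x , nx , refl) | yes (y , ny , refl) = across i x y nx ny a
  ... | yes (x , nx , refl) | no ¬gl = enter i x q nx (¬glued⇒free ¬gl) a
  ... | no ¬gl | yes (y , ny , refl) = leave i p y (¬glued⇒free ¬gl) ny a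
  ... | no ¬gp | no ¬gq = inside i p q (¬glued⇒free ¬gp) (¬glued⇒free ¬gq) a

  GAdj⇒Edge : ∀ {u v} → GAdj u v → Edge (nf u) (nf v)
  GAdj⇒Edge (u' , v' , u≈u' , v≈v' , a) =
    subst₂ Edge (sym (≈⇒nf≡ u≈u')) (sym (≈⇒nf≡ v≈v')) (XAdj⇒Edge u' v' a)

  -- An edge leaving a canonical vertex is determined by the neighbour in G*,
  -- resp. in F_i, that it heads to, because glued vertices are leaves of F_i.
  stemStep : ∀ {x n} → Edge (inj₁ x) n → V* r m
  stemStep (stemEdge _ y _)     = inj₁ y
  stemStep (enter i _ _ _ _ _)  = inj₂ i
  stemStep (across i _ _ _ _ _) = inj₂ i

  stemStep-adj : ∀ {x n} (e : Edge (inj₁ x) n) → E* (inj₁ x) (stemStep e)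
  stemStep-adj (stemEdge _ _ a)      = a
  stemStep-adj (enter _ _ _ nx _ _)  = nx
  stemStep-adj (across _ _ _ nx _ _) = nx

  stemStep-injective : ∀ {x n n'} (e : Edge (inj₁ x) n) (e' : Edge (inj₁ x) n')
    → stemStep e ≡ stemStep e' → n ≡ n'
  stemStep-injective (stemEdge _ _ _) (stemEdge _ _ _) refl = refl
  stemStep-injective (enter i x q nx _ a) (enter _ _ _ _ _ a') refl =
    cong (λ q → inj₂ (i , q)) (glued-neighbour-unique nx a a')
  stemStep-injective (enter i x q nx fq a) (across _ _ y _ ny a') refl =
    ⊥-elim (fq y ny (glued-neighbour-unique nx a' a))
  stemStep-injective (across i x y nx ny a) (enter _ _ q _ fq a') refl =
    ⊥-elim (fq y ny (glued-neighbour-unique nx a a'))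
  stemStep-injective (across i x y nx ny a) (across _ _ y' _ ny' a') refl =
    cong inj₁ (gInj i y y' ny ny' (glued-neighbour-unique nx a a'))

  blockStep : ∀ {i p n} → Edge (inj₂ (i , p)) n → Pos i
  blockStep (leave i _ y _ _ _)  = g i y
  blockStep (inside _ _ q _ _ _) = q

  blockStep-adj : ∀ {i p n} (e : Edge (inj₂ (i , p)) n) → AdjF i p (blockStep e)
  blockStep-adj (leave _ _ _ _ _ a)  = a
  blockStep-adj (inside _ _ _ _ _ a) = a

  blockStep-injective : ∀ {i p n n'} (e : Edge (inj₂ (i , p)) n) (e' : Edge (inj₂ (i , p)) n')
    → blockStep e ≡ blockStep e' → n ≡ n'
  blockStep-injective (leave i _ y _ ny _) (leave _ _ y' _ ny' _) eq = cong inj₁ (gInj i y y' ny ny' eq)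
  blockStep-injective (leave _ _ y _ ny _) (inside _ _ _ _ fq _) eq = ⊥-elim (fq y ny eq)
  blockStep-injective (inside _ _ _ _ fq _) (leave _ _ y _ ny _) eq = ⊥-elim (fq y ny (sym eq))
  blockStep-injective (inside _ _ _ _ _ _) (inside _ _ _ _ _ _) refl = refl

  π₀ : X → V* r m
  π₀ (inj₁ x)       = inj₁ x
  π₀ (inj₂ (i , _)) = inj₂ i

  open TreePaths (Sumₚ.≡-dec Finₚ._≟_ Finₚ._≟_) stemTree

  -- A non-backtracking walk of canonical vertices from c₀ is followed by the
  -- reversed path `track` of G* from π₀ c₀ to the projection of the current
  -- vertex and, inside F_i, by the walk in T_d from the word w₀ at which it
  -- entered F_i (or started).  By stemStep-injective and blockStep-injective
  -- neither of them backtracks, so the walk cannot come back to c₀.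
  Origin : X → V* r m → List (V* r m) → Set
  Origin c₀ h track = (track ≡ [] × h ≡ π₀ c₀) ⊎ π₀ c₀ ∈ track

  Origin-∷ : ∀ {c₀ h h' track} → Origin c₀ h track → Origin c₀ h' (h ∷ track)
  Origin-∷ (inj₁ (refl , refl)) = inj₂ (here refl)
  Origin-∷ (inj₂ c₀∈)           = inj₂ (there c₀∈)

  data ArrivedAtStem (x : Fin r) : Maybe X → List (V* r m) → Set where
    fresh : ArrivedAtStem x nothing []
    via   : ∀ {n track} (e : Edge (inj₁ x) n) → ArrivedAtStem x (just n) (stemStep e ∷ track)

  data ArrivedInBlock {i : Fin m} (q : Pos i) : Maybe X → Maybe (Pos i) → Set where
    fresh : ArrivedInBlock q nothing nothing
    via   : ∀ {n} (e : Edge (inj₂ (i , q)) n) → ArrivedInBlock q (just n) (just (blockStep e))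

  data Entry : X → (i : Fin m) → List (V* r m) → Word d → Set where
    started : ∀ {i} q₀ → Entry (inj₂ (i , q₀)) i [] (word i q₀)
    entered : ∀ {c₀ i y track} → Nb i y → Entry c₀ i (inj₁ y ∷ track) (word i (g i y))

  record StemState (c₀ : X) (prev : Maybe X) (x : Fin r) : Set where
    field
      track   : List (V* r m)
      path!   : Distinct (inj₁ x ∷ track)
      path    : Chain E* (inj₁ x ∷ track)
      origin  : Origin c₀ (inj₁ x) track
      arrival : ArrivedAtStem x prev track

  record BlockState (c₀ : X) (prev : Maybe X) (i : Fin m) (q : Pos i) : Set where
    field
      track   : List (V* r m)
      path!   : Distinct (inj₂ i ∷ track)
      path    : Chain E* (inj₂ i ∷ track)
      origin  : Origin c₀ (inj₂ i) track
      w₀      : Word d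
      entry   : Entry c₀ i track w₀
      prevPos : Maybe (Pos i)
      arrival : ArrivedInBlock q prev prevPos
      walk    : Walk w₀ (Maybe.map (word i) prevPos) (word i q)

  State : X → Maybe X → X → Set
  State c₀ prev (inj₁ x)       = StemState c₀ prev x
  State c₀ prev (inj₂ (i , q)) = BlockState c₀ prev i q

  Forward : Maybe X → X → Set
  Forward nothing  n = ⊤
  Forward (just a) n = a ≢ n

  start-state : ∀ c₀ → State c₀ nothing c₀
  start-state (inj₁ x) = record
    { track = [] ; path! = [] ∷ [] ; path = tt ; origin = inj₁ (refl , refl) ; arrival = fresh }
  start-state (inj₂ (i , q)) = record
    { track = [] ; path! = [] ∷ [] ; path = tt ; origin = inj₁ (refl , refl)
    ; w₀ = word i q ; entry = started q ; prevPos = nothing ; arrival = fresh ; walk = start }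

  stem-forward : ∀ {x prev track n} → ArrivedAtStem x prev track
    → (e : Edge (inj₁ x) n) → Forward prev n → NotBack (stemStep e) track
  stem-forward fresh     e _   = tt
  stem-forward (via e') e a≢n = λ same → a≢n (sym (stemStep-injective e e' same))

  block-forward : ∀ {i q prev prevPos n} → ArrivedInBlock q prev prevPos
    → (e : Edge (inj₂ (i , q)) n) → Forward prev n
    → ∀ w → Maybe.map (word i) prevPos ≡ just w → word i (blockStep e) ≢ w
  block-forward (via e') e a≢n _ refl same =
    a≢n (sym (blockStep-injective e e' (word-injective _ same)))

  exit-forward : ∀ {c₀ i track w₀ y prev} → Entry c₀ i track w₀
    → Walk w₀ (just prev) (word i (g i y)) → NotBack (inj₁ y) track
  exit-forward (started _) _    = tt
  exit-forward (entered _) walk refl = Walk-away walk refl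

  step-stem : ∀ {c₀ prev x n} → StemState c₀ prev x → (e : Edge (inj₁ x) n) → Forward prev n
    → State c₀ (just (inj₁ x)) n
  step-stem s e@(stemEdge x y a) onward = record
    { track = inj₁ x ∷ track ; path! = extend-path path! path a (stem-forward arrival e onward)
    ; path = E*-sym a , path ; origin = Origin-∷ origin
    ; arrival = via (stemEdge y x (E*-sym a)) }
    where open StemState s
  step-stem s e@(enter i x q nx fq a) onward = record
    { track = inj₁ x ∷ track ; path! = extend-path path! path nx (stem-forward arrival e onward)
    ; path = E*-sym nx , path ; origin = Origin-∷ origin
    ; w₀ = word i (g i x) ; entry = entered nx
    ; prevPos = just (g i x) ; arrival = via (leave i q x fq nx (AdjF-sym a))
    ; walk = Walk-step start a (λ _ ()) }
    where open StemState s
  step-stem s e@(across i x y nx ny a) onward = record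
    { track = inj₂ i ∷ inj₁ x ∷ track
    ; path! = extend-path (extend-path path! path nx (stem-forward arrival e onward)) (E*-sym nx , path)
                     (E*-sym ny) (λ { refl → adjT-irrefl (word i (g i x)) a })
    ; path = ny , E*-sym nx , path ; origin = Origin-∷ (Origin-∷ origin)
    ; arrival = via (across i y x ny nx (AdjF-sym a)) }
    where open StemState s

  step-block : ∀ {c₀ prev i q n} → BlockState c₀ prev i q → (e : Edge (inj₂ (i , q)) n)
    → Forward prev n → State c₀ (just (inj₂ (i , q))) n
  step-block s e@(inside i q q' fq fq' a) onward = record
    { track = track ; path! = path! ; path = path ; origin = origin ; w₀ = w₀ ; entry = entry
    ; prevPos = just q ; arrival = via (inside i q' q fq' fq (AdjF-sym a))
    ; walk = Walk-step walk a (block-forward arrival e onward) }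
    where open BlockState s
  step-block s e@(leave i q y fq ny a) onward = record
    { track = inj₂ i ∷ track
    ; path! = extend-path path! path (E*-sym ny)
                     (exit-forward entry (Walk-step walk a (block-forward arrival e onward)))
    ; path = ny , path ; origin = Origin-∷ origin
    ; arrival = via (enter i y q ny fq (AdjF-sym a)) }
    where open BlockState s

  step : ∀ {c₀ prev c n} → State c₀ prev c → Edge c n → Forward prev n → State c₀ (just c) n
  step {c = inj₁ _}       = step-stem
  step {c = inj₂ (_ , _)} = step-block

  stem-no-return : ∀ {x a track} → Distinct (inj₁ x ∷ track) → Origin (inj₁ x) (inj₁ x) track
    → ¬ ArrivedAtStem x (just a) track
  stem-no-return path! (inj₂ x∈)         _  = Distinct-head∉ path! x∈
  stem-no-return _     (inj₁ (refl , _)) ()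

  block-no-return : ∀ {i q a track w₀ prevPos} → Distinct (inj₂ i ∷ track)
    → Origin (inj₂ (i , q)) (inj₂ i) track → Entry (inj₂ (i , q)) i track w₀
    → ArrivedInBlock q (just a) prevPos → ¬ Walk w₀ (Maybe.map (word i) prevPos) (word i q)
  block-no-return path! (inj₂ i∈)         _           _       _    = Distinct-head∉ path! i∈
  block-no-return _     (inj₁ (refl , _)) (started _) (via _) walk = Walk-away walk refl

  no-return : ∀ {c₀ a} → ¬ State c₀ (just a) c₀
  no-return {inj₁ _} s = stem-no-return path! origin arrival
    where open StemState s
  no-return {inj₂ _} s = block-no-return path! origin entry arrival walk
    where open BlockState s

  walk-no-return : ∀ c₀ a c ws → Chain Edge (c ∷ ws ++ [ c₀ ])
    → Chain₂ _≢_ (a ∷ c ∷ ws ++ [ c₀ ]) → ¬ State c₀ (just a) c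
  walk-no-return c₀ a c []       (e , _)  (a≢c₀ , _) s = no-return (step s e a≢c₀)
  walk-no-return c₀ a c (n ∷ ws) (e , es) (a≢n , nb) s = walk-no-return c₀ c n ws es nb (step s e a≢n)

  GAdj-acyclic : ∀ v vs → 2 ≤ length vs → AllPairs (λ a b → ¬ (a ≈ b)) (v ∷ vs)
    → ¬ Chain GAdj (v ∷ vs ++ [ v ])
  GAdj-acyclic v (b ∷ []) (s≤s ()) _ _
  GAdj-acyclic v (b ∷ c ∷ vs) _ ((v≉b ∷ v≉c ∷ v≉vs) ∷ vs!) cycle =
    walk-no-return (nf v) (nf v) (nf b) (map nf (c ∷ vs)) (proj₂ edges) apart
      (step (start-state (nf v)) (proj₁ edges) tt)
    where
      nf-cycle : map nf (v ∷ b ∷ (c ∷ vs) ++ [ v ]) ≡ nf v ∷ nf b ∷ map nf (c ∷ vs) ++ [ nf v ]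
      nf-cycle = cong (λ zs → nf v ∷ nf b ∷ zs) (map-++ nf (c ∷ vs) [ v ])
      edges : Chain Edge (nf v ∷ nf b ∷ map nf (c ∷ vs) ++ [ nf v ])
      edges = subst (Chain Edge) nf-cycle (Chain-map nf GAdj⇒Edge _ cycle)
      apart : Chain₂ _≢_ (nf v ∷ nf b ∷ map nf (c ∷ vs) ++ [ nf v ])
      apart = subst (Chain₂ _≢_) nf-cycle (Chain₂-map nf (λ u≉w → u≉w ∘ nf≡⇒≈) _
                (v≉c , AllPairs⇒Chain₂-∷ʳ v (b ∷ c ∷ vs) vs!
                         (All.map (λ v≉w → v≉w ∘ ≈-sym) (v≉b ∷ v≉c ∷ v≉vs))))

  block-path : ∀ i {a b} → Star (λ a b → (a ∈ F i) × (b ∈ F i) × (adjT a b ≡ true)) a b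
    → ∀ p q → word i p ≡ a → word i q ≡ b → Star (AdjF i) p q
  block-path i ε p q refl q≡ with word-injective i (sym q≡)
  ... | refl = ε
  block-path i ((_ , c∈ , a) ◅ rest) p q refl q≡ =
    subst (λ w → adjT (word i p) w ≡ true) (lookup-index c∈) a
      ◅ block-path i rest (index c∈) q (sym (lookup-index c∈)) q≡

  block-connected : ∀ i p q → Star (AdjF i) p q
  block-connected i p q =
    block-path i (IsDomain.connected (domainF i) _ _ (∈-lookup p) (∈-lookup q)) p q refl refl

  Link : X → X → Set
  Link a b = (a ≈ b) ⊎ GAdj a b

  GAdj-block : ∀ {i p q} → AdjF i p q → GAdj (inj₂ (i , p)) (inj₂ (i , q))
  GAdj-block a = _ , _ , ε , ε , refl , a

  block-linked : ∀ i p q → Star Link (inj₂ (i , p)) (inj₂ (i , q))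
  block-linked i p q = gmap (λ p → inj₂ (i , p)) (inj₂ ∘ GAdj-block) (block-connected i p q)

  Over : X → V* r m → Set
  Over u (inj₁ x) = u ≡ inj₁ x
  Over u (inj₂ i) = ∃ λ p → u ≡ inj₂ (i , p)

  Over-π₀ : ∀ u → Over u (π₀ u)
  Over-π₀ (inj₁ x)       = refl
  Over-π₀ (inj₂ (i , p)) = p , refl

  some-over : ∀ s → ∃ λ u → Over u s
  some-over (inj₁ x) = inj₁ x , refl
  some-over (inj₂ i) = inj₂ (i , p) , p , refl
    where p = index (proj₂ (IsDomain.nonempty (domainF i)))

  fibre-linked : ∀ {s u v} → Over u s → Over v s → Star Link u v
  fibre-linked {inj₁ _} refl     refl     = ε
  fibre-linked {inj₂ i} (p , refl) (q , refl) = block-linked i p q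

  stem-linked : ∀ {s t u v} → E* s t → Over u s → Over v t → Star Link u v
  stem-linked {inj₁ x} {inj₁ y} e refl refl = inj₂ (inj₁ x , inj₁ y , ε , ε , e) ◅ ε
  stem-linked {inj₁ x} {inj₂ i} e refl (q , refl) =
    inj₁ (fwd (ident i x e) ◅ ε) ◅ block-linked i (g i x) q
  stem-linked {inj₂ i} {inj₁ x} e (p , refl) refl =
    block-linked i p (g i x) ◅◅ inj₁ (bwd (ident i x (E*-sym e)) ◅ ε) ◅ ε
  stem-linked {inj₂ i} {inj₂ j} e _ _ with () ← trans (sym e) (IsStemDiagram.noBB stem i j)

  lift-path : ∀ {s t u v} → Star (λ a b → (a ≡ b) ⊎ E* a b) s t
    → Over u s → Over v t → Star Link u v
  lift-path ε                  ou ov = fibre-linked ou ov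
  lift-path (inj₁ refl ◅ rest) ou ov = lift-path rest ou ov
  lift-path (inj₂ e ◅ rest)    ou ov = stem-linked e ou (proj₂ w) ◅◅ lift-path rest (proj₂ w) ov
    where w = some-over _

  GAdj-connected : ∀ u v → Star Link u v
  GAdj-connected u v = lift-path (IsTree.connected stemTree (π₀ u) (π₀ v)) (Over-π₀ u) (Over-π₀ v)

  XAdj-sym : ∀ u v → XAdj u v → XAdj v u
  XAdj-sym (inj₁ x)       (inj₁ y)        a          = E*-sym a
  XAdj-sym (inj₂ (i , p)) (inj₂ (.i , q)) (refl , a) = refl , AdjF-sym a

  G-tree : IsTree X _≈_ GAdj
  G-tree = record
    { point     = proj₁ (some-over (IsTree.point stemTree))
    ; symmetric = λ { u v (u' , v' , u≈u' , v≈v' , a) → v' , u' , v≈v' , u≈u' , XAdj-sym u' v' a }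
    ; loopless  = λ u v a u≈v → Edge-irrefl (subst (Edge (nf u)) (sym (≈⇒nf≡ u≈v)) (GAdj⇒Edge a))
    ; connected = GAdj-connected
    ; acyclic   = GAdj-acyclic
    }

  ∈-allV* : ∀ v → v ∈ allV* r m
  ∈-allV* (inj₁ x) = ∈-++⁺ˡ (∈-map⁺ inj₁ (∈-allFin x))
  ∈-allV* (inj₂ i) = ∈-++⁺ʳ (map inj₁ (allFin r)) (∈-map⁺ inj₂ (∈-allFin i))

  canonical-degree≤ : ∀ {c} → Canonical c → (ns : List X) → Distinct ns
    → (∀ {n} → n ∈ ns → Edge c n) → length ns ≤ d
  canonical-degree≤ (stemVertex x) ns ns! edge =
    ≤-trans (Distinct-length≤ ns! f f-injective) (≤-trans (proj₂ (degR x)) (m∸n≤m d 1))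
    where
      e : ∀ j → Edge (inj₁ x) (lookup ns j)
      e j = edge (∈-lookup j)
      neighbours : List (V* r m)
      neighbours = filterᵇ (adj (inj₁ x)) (allV* r m)
      heads-to : ∀ j → stemStep (e j) ∈ neighbours
      heads-to j = ∈-filterᵇ⁺ (adj (inj₁ x)) (∈-allV* _) (stemStep-adj (e j))
      f : Fin (length ns) → Fin (deg* adj (inj₁ x))
      f j = index (heads-to j)
      f-injective : ∀ j j' → f j ≡ f j' → lookup ns j ≡ lookup ns j'
      f-injective j j' eq = stemStep-injective (e j) (e j')
        (trans (lookup-index (heads-to j))
               (trans (cong (lookup neighbours) eq) (sym (lookup-index (heads-to j')))))
  canonical-degree≤ (freeVertex i p _) ns ns! edge = Distinct-length≤ ns! f f-injective
    where
      e : ∀ j → Edge (inj₂ (i , p)) (lookup ns j)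
      e j = edge (∈-lookup j)
      f : Fin (length ns) → Fin d
      f j = letter (word i p) (word i (blockStep (e j))) (blockStep-adj (e j))
      f-injective : ∀ j j' → f j ≡ f j' → lookup ns j ≡ lookup ns j'
      f-injective j j' eq = blockStep-injective (e j) (e j') (word-injective i
        (letter-injective _ _ _ _ _ (word-reduced i _) (word-reduced i _) eq))

  G-maxDegree : MaxDegree≤ _≈_ GAdj d
  G-maxDegree v ns ns! adjacent =
    subst (_≤ d) (length-map nf ns)
      (canonical-degree≤ (nf-canonical v) (map nf ns)
        (AllPairs.map⁺ (AllPairs.map (λ u≉w → u≉w ∘ nf≡⇒≈) ns!)) edge)
    where
      edge : ∀ {n} → n ∈ map nf ns → Edge (nf v) n
      edge n∈ with ∈-map⁻ nf n∈
      ... | w , w∈ , refl = GAdj⇒Edge (adjacent w w∈)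

  ω-injective-R : ∀ x y → inj₁ x ≈ inj₁ y → x ≡ y
  ω-injective-R x y x≈y = Sumₚ.inj₁-injective (≈⇒nf≡ x≈y)

  ω-injective-F' : ∀ i p q → InF' i p → InF' i q → inj₂ (i , p) ≈ inj₂ (i , q) → p ≡ q
  ω-injective-F' i p q fp fq p≈q with trans (sym (nf-free fp)) (trans (≈⇒nf≡ p≈q) (nf-free fq))
  ... | refl = refl

  InB⇒nf : ∀ {i v} → InB i v → ∃ λ p → InF' i p × nf v ≡ inj₂ (i , p)
  InB⇒nf (p , fp , v≈p) = p , fp , trans (≈⇒nf≡ v≈p) (nf-free fp)

  nf⇒InB : ∀ {i v p} → InF' i p → nf v ≡ inj₂ (i , p) → InB i v
  nf⇒InB {v = v} fp eq = _ , fp , subst (v ≈_) eq (≈-nf v)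

  nf⇒InωR : ∀ {v x} → nf v ≡ inj₁ x → InωR v
  nf⇒InωR {v} eq = _ , subst (v ≈_) eq (≈-nf v)

  covered : ∀ v → InωR v ⊎ (∃ λ i → InB i v)
  covered v with nf v in eq | nf-canonical v
  ... | _ | stemVertex x      = inj₁ (nf⇒InωR eq)
  ... | _ | freeVertex i p fp = inj₂ (i , nf⇒InB fp eq)

  ωR-disjoint-B : ∀ v i → InωR v → ¬ InB i v
  ωR-disjoint-B v i (x , v≈x) vB with trans (sym (≈⇒nf≡ v≈x)) (proj₂ (proj₂ (InB⇒nf vB)))
  ... | ()

  B-disjoint : ∀ v i j → InB i v → InB j v → i ≡ j
  B-disjoint v i j vBi vBj with trans (sym (proj₂ (proj₂ (InB⇒nf vBi)))) (proj₂ (proj₂ (InB⇒nf vBj)))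
  ... | refl = refl

  projection : ∃ λ (π : X → V* r m)
    → (∀ u v → u ≈ v → π u ≡ π v) × (∀ x → π (inj₁ x) ≡ inj₁ x)
    × (∀ i v → InB i v → π v ≡ inj₂ i)
  projection = π₀ ∘ nf , (λ u v u≈v → cong π₀ (≈⇒nf≡ u≈v)) , (λ x → refl)
             , (λ i v vB → cong π₀ (proj₂ (proj₂ (InB⇒nf vB))))

  AdjOff-preserves-B : ∀ {i u w} → AdjOff u w → InB i u → InB i w
  AdjOff-preserves-B {w = w} (_ , w∉ωR , a) uB with InB⇒nf uB
  ... | p , _ , eq = off-stem (subst (λ z → Edge z (nf w)) eq (GAdj⇒Edge a)) refl
    where
      off-stem : ∀ {i p n} → Edge (inj₂ (i , p)) n → nf w ≡ n → InB i w
      off-stem (leave _ _ _ _ _ _)   eq = ⊥-elim (w∉ωR (nf⇒InωR eq))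
      off-stem (inside _ _ _ _ fq _) eq = nf⇒InB fq eq

  FreeAdj : (i : Fin m) → Pos i → Pos i → Set
  FreeAdj i p q = InF' i p × InF' i q × AdjF i p q

  -- A glued vertex is a leaf of F_i, so a path between free vertices that
  -- passes through it must turn back there.
  prune : ∀ {i p q} → InF' i p → InF' i q → Star (AdjF i) p q → Star (FreeAdj i) p q
  prune fp fq ε = ε
  prune {i} fp fq (_◅_ {j = c} a rest) with glued? i c
  prune fp fq (a ◅ rest)      | no ¬gl = (fp , ¬glued⇒free ¬gl , a) ◅ prune (¬glued⇒free ¬gl) fq rest
  prune fp fq (a ◅ ε)         | yes (y , ny , refl) = ⊥-elim (fq y ny refl)
  prune fp fq (a ◅ a' ◅ rest) | yes gl
    with refl ← leaf-neighbour-unique _ _ (glued-leaf gl) (AdjF-sym a) a' = prune fp fq rest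

  free-¬InωR : ∀ {i p} → InF' i p → ¬ InωR (inj₂ (i , p))
  free-¬InωR fp (x , p≈x) with trans (sym (nf-free fp)) (≈⇒nf≡ p≈x)
  ... | ()

  B-connected : ∀ {i u v} → InB i u → InB i v → Star AdjOff u v
  B-connected {i} {u} {v} uB vB with InB⇒nf uB | InB⇒nf vB
  ... | p , fp , eu | q , fq , ev with refl ← nf≡inj₂ u eu | refl ← nf≡inj₂ v ev =
    gmap (λ p → inj₂ (i , p))
         (λ { (fp , fq , a) → free-¬InωR fp , free-¬InωR fq , GAdj-block a })
         (prune fp fq (block-connected i p q))

  B-components : ∀ u v i j → InB i u → InB j v
    → (Star AdjOff u v → i ≡ j) × (i ≡ j → Star AdjOff u v)
  B-components u v i j uB vB =
      (λ u~v → B-disjoint v i j (Star-preserves-B u~v uB) vB)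
    , (λ { refl → B-connected uB vB })
    where
      Star-preserves-B : ∀ {u v} → Star AdjOff u v → InB i u → InB i v
      Star-preserves-B ε             uB = uB
      Star-preserves-B (a ◅ u~v) uB = Star-preserves-B u~v (AdjOff-preserves-B a uB)

lemma7p12 : (d : ℕ) → 2 ≤ d → (r m : ℕ) (adj : V* r m → V* r m → Bool)
    → (F : Fin m → List (Word d)) (g : (i : Fin m) → Fin r → Fin (length (F i)))
    → Datum.Admissible d r m adj F g
    → let open Datum d r m adj F g in
      -- G is a finite tree with all degrees ≤ d
      IsTree X _≈_ GAdj
      × MaxDegree≤ _≈_ GAdj d
      -- (a) ω injective on R and on each F_i'
      × (∀ x y → inj₁ x ≈ inj₁ y → x ≡ y)
      × (∀ i p q → InF' i p → InF' i q → inj₂ (i , p) ≈ inj₂ (i , q) → p ≡ q)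
      -- (b) V(G) = ω(R) ⊔ B_1 ⊔ … ⊔ B_m
      × (∀ v → InωR v ⊎ (∃ λ i → InB i v))
      × (∀ v i → InωR v → ¬ InB i v)
      × (∀ v i j → InB i v → InB j v → i ≡ j)
      -- (c) π : G → G* (well defined on classes), identity on ω(R), B_i ↦ b_i
      × (∃ λ (π : X → V* r m)
           → (∀ u v → u ≈ v → π u ≡ π v)
           × (∀ x → π (inj₁ x) ≡ inj₁ x)
           × (∀ i v → InB i v → π v ≡ inj₂ i))
      -- (d) the B_i are exactly the connected components of G ∖ ω(R)
      × (∀ u v i j → InB i u → InB j v → (Star AdjOff u v → i ≡ j) × (i ≡ j → Star AdjOff u v))
lemma7p12 d _ r m adj F g A =
  G-tree , G-maxDegree , ω-injective-R , ω-injective-F' , covered , ωR-disjoint-B , B-disjoint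
  , projection , B-components
  where open Gluing d r m adj F g A
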